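{- Let $n\ge 1$ and $k\ge 0$ be integers, and let $\mathcal{M}=(E,\mathcal{B})$ be a cyclic $k$-matroid on the ground set $E=\{0,1,\ldots,n-1\}$. Then $\{0,1,\ldots,k-1\}$ is a basis of $\mathcal{M}$, i.e. $\{0,1,\ldots,k-1\}\in\mathcal{B}$.
   Context: Matroids are given by their collection of bases $\mathcal{B}$. The ground set $E=\{0,1,\ldots,n-1\}$ is identified with $\mathbb{Z}_n$, and arithmetic on elements of $E$ is modulo $n$. For $s\in\mathbb{Z}_n$ and $A\subseteq E$, $s+A=\{s+a: a\in A\}$. A matroid $\mathcal{M}=(E,\mathcal{B})$ on $E$ is a cyclic $k$-matroid if it has rank $k$ and its set of bases is closed under cyclic shifts: $A\in\mathcal{B}$ implies $s+A\in\mathcal{B}$ for every $s\in\mathbb{Z}_n$ (equivalently, the $n$-cycle $i\mapsto i+1 \bmod n$ is an automorphism of $\mathcal{M}$). -}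

module Defs where

open import Data.Nat using (ℕ; _+_; _∸_; _<_; NonZero)
open import Data.Nat.DivMod using (_mod_)
open import Data.Fin using (Fin; toℕ)
open import Data.Fin.Subset using (Subset; _∈_; _∉_; _∪_; _-_; ⁅_⁆; ∣_∣)
open import Data.Vec using (tabulate; lookup)
open import Data.Bool using (Bool; true; false)
open import Data.Product using (Σ; ∃; _×_)
open import Relation.Binary.PropositionalEquality using (_≡_)

record IsMatroidBases (n : ℕ) (Basis : Subset n → Set) : Set where
  field
    nonempty : Σ (Subset n) Basis
    exchange : ∀ B₁ B₂ → Basis B₁ → Basis B₂ →
               ∀ x → x ∈ B₁ → x ∉ B₂ →
               ∃ λ y → y ∈ B₂ × y ∉ B₁ × Basis ((B₁ - x) ∪ ⁅ y ⁆)

HasRank : (n : ℕ) → (Subset n → Set) → ℕ → Set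
HasRank n Basis k = ∀ B → Basis B → ∣ B ∣ ≡ k

_+ₙ_ : {n : ℕ} .{{_ : NonZero n}} → Fin n → Fin n → Fin n
_+ₙ_ {n} a b = (toℕ a + toℕ b) mod n

_-ₙ_ : {n : ℕ} .{{_ : NonZero n}} → Fin n → Fin n → Fin n
_-ₙ_ {n} a b = (toℕ a + (n ∸ toℕ b)) mod n

-- s + A = { s + a : a ∈ A };  y ∈ s + A  iff  y - s ∈ A
shift : {n : ℕ} .{{_ : NonZero n}} → Fin n → Subset n → Subset n
shift s A = tabulate (λ y → lookup A (y -ₙ s))

record IsCyclicMatroid (n : ℕ) .{{_ : NonZero n}} (k : ℕ) (Basis : Subset n → Set) : Set where
  field
    isMatroid : IsMatroidBases n Basis
    rank      : HasRank n Basis k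
    cyclic    : ∀ (s : Fin n) A → Basis A → Basis (shift s A)

initSeg : (n k : ℕ) → Subset n
initSeg n k = tabulate (λ (i : Fin n) → isLess (toℕ i) k)
  where
  isLess : ℕ → ℕ → Bool
  isLess _ ℕ.zero = false
  isLess ℕ.zero (ℕ.suc _) = true
  isLess (ℕ.suc a) (ℕ.suc b) = isLess a b

-- By induction on j ≤ k, {0, …, j−1} is independent: a basis
-- containing it has k > j elements, hence some e ≥ j, so J = {0, …, j−1, e} is independent, and it
-- suffices to lower e to j. The shift I = {1, …, j} of {0, …, j−1} is independent with I ∖ J ⊆ {j};
-- extending I to a basis as close as possible to one containing J, basis exchange shows that this
-- basis misses at most one element of J. So {0, …, j} = I ∪ {0} or I ∪ {e} is independent, and
-- shifting I ∪ {e} back by one replaces e by e − 1 in J.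

module Submission where

open import Defs
open import Level using (0ℓ; _⊔_)
open import Data.Nat using (ℕ; zero; suc; _+_; _∸_; _≤_; _<_; z≤n; s≤s; z<s; NonZero; _%_; _≤?_)
open import Data.Nat.Properties
  using (≤-refl; ≤-reflexive; ≤-trans; ≤-antisym; <-trans; ≤-<-trans; <-≤-trans; <⇒≤; <⇒≱; ≤⇒≯;
         ≰⇒>; ≮⇒≥; n≢0⇒n>0; +-comm; +-suc; +-identityʳ; +-∸-comm; +-∸-assoc; m∸n≤m; m∸[m∸n]≡n;
         m+[n∸m]≡n; m<m+n; +-monoˡ-<; ∸-monoʳ-<; ∸-monoˡ-<; m<1+n⇒m<n∨m≡n; m<1+n⇒m≤n; module ≤-Reasoning)
open import Data.Nat.DivMod using (_mod_; m<n⇒m%n≡m; [m+n]%n≡m%n)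
open import Data.Nat.Induction using (<-wellFounded)
open import Induction.WellFounded using (Acc; acc)
open import Data.Fin using (Fin; toℕ; fromℕ<)
open import Data.Fin.Properties using (toℕ-fromℕ<; toℕ<n; toℕ-injective; any?; _≟_)
open import Data.Fin.Subset
  using (Subset; _∈_; _∉_; _─_; _-_; ⁅_⁆; ∣_∣; inside; outside)
  renaming (_∪_ to _∪ˢ_; _⊆_ to _⊆ˢ_)
open import Data.Fin.Subset.Properties
  using (_∈?_; x∈⁅x⁆; x∈⁅y⁆⇒x≡y; x∈p∪q⁻; p⊆p∪q; q⊆p∪q; p⊆q⇒∣p∣≤∣q∣; p⊂q⇒∣p∣<∣q∣; ∣p∣≤n; ⊆-antisym)
open import Data.Vec using (_∷_; here; there)
open import Data.Vec.Properties using (lookup∘tabulate; []=⇒lookup; lookup⇒[]=)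
open import Data.Product using (∃; _×_; _,_; proj₁; proj₂)
open import Data.Sum as Sum using (_⊎_; inj₁; inj₂; [_,_]′)
open import Function using (id; _∘_)
open import Relation.Nullary using (yes; no; contradiction)
open import Relation.Nullary.Decidable using (_×-dec_; ¬?; decidable-stable)
open import Relation.Unary using (Pred; Decidable; _⊆_; _∪_; _∖_; ｛_｝)
open import Relation.Binary.PropositionalEquality using (_≡_; _≢_; refl; sym; trans; cong; subst; module ≡-Reasoning)

AtMostOne : ∀ {a ℓ} {A : Set a} → Pred A ℓ → Set (a ⊔ ℓ)
AtMostOne P = ∀ {x y} → P x → P y → x ≡ y

private
  variable
    n : ℕ
    p q : Subset n
    x y z : Fin n

x∈p─q⁺ : x ∈ p → x ∉ q → x ∈ p ─ q
x∈p─q⁺ {q = inside  ∷ q} here        x∉q = contradiction here x∉q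
x∈p─q⁺ {q = outside ∷ q} here        x∉q = here
x∈p─q⁺ {q = _       ∷ q} (there x∈p) x∉q = there (x∈p─q⁺ x∈p (x∉q ∘ there))

x∈p─q⁻ : ∀ (p q : Subset n) → x ∈ p ─ q → x ∈ p × x ∉ q
x∈p─q⁻ (inside  ∷ p) (outside ∷ q) here = here , λ ()
x∈p─q⁻ {x = Fin.zero} (inside  ∷ p) (inside  ∷ q) ()
x∈p─q⁻ {x = Fin.zero} (outside ∷ p) (inside  ∷ q) ()
x∈p─q⁻ {x = Fin.zero} (outside ∷ p) (outside ∷ q) ()
x∈p─q⁻ (_       ∷ p) (_       ∷ q) (there x∈p─q) with x∈p─q⁻ p q x∈p─q
... | x∈p , x∉q = there x∈p , λ { (there x∈q) → x∉q x∈q }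

_[_↦_] : Subset n → Fin n → Fin n → Subset n
p [ x ↦ y ] = (p - x) ∪ˢ ⁅ y ⁆

∈-↦⁺ : ∀ {y} → z ∈ p → z ≢ x → z ∈ p [ x ↦ y ]
∈-↦⁺ z∈p z≢x = p⊆p∪q _ (x∈p─q⁺ z∈p (z≢x ∘ x∈⁅y⁆⇒x≡y _))

∈-↦-new : ∀ p (x y : Fin n) → y ∈ p [ x ↦ y ]
∈-↦-new p x y = q⊆p∪q (p - x) ⁅ y ⁆ (x∈⁅x⁆ y)

∈-↦⁻ : ∀ p (x y : Fin n) → z ∈ p [ x ↦ y ] → z ∈ p × z ≢ x ⊎ z ≡ y
∈-↦⁻ p x y z∈ with x∈p∪q⁻ (p - x) ⁅ y ⁆ z∈
... | inj₂ z∈⁅y⁆ = inj₂ (x∈⁅y⁆⇒x≡y y z∈⁅y⁆)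
... | inj₁ z∈p-x with x∈p─q⁻ p ⁅ x ⁆ z∈p-x
...   | z∈p , z∉⁅x⁆ = inj₁ (z∈p , λ { refl → z∉⁅x⁆ (x∈⁅x⁆ x) })

∣p[x↦y]─q∣<∣p─q∣ : x ∈ p → x ∉ q → y ∈ q → ∣ p [ x ↦ y ] ─ q ∣ < ∣ p ─ q ∣
∣p[x↦y]─q∣<∣p─q∣ {x = x} {p} {q} {y} x∈p x∉q y∈q =
  p⊂q⇒∣p∣<∣q∣ (shrinks , x , x∈p─q⁺ x∈p x∉q , x-removed)
  where
  x-removed : x ∉ p [ x ↦ y ] ─ q
  x-removed x∈ with x∈p─q⁻ _ q x∈
  ... | x∈p′ , _ with ∈-↦⁻ p x y x∈p′
  ...   | inj₁ (_ , x≢x) = x≢x refl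
  ...   | inj₂ refl      = x∉q y∈q
  shrinks : p [ x ↦ y ] ─ q ⊆ˢ p ─ q
  shrinks z∈ with x∈p─q⁻ _ q z∈
  ... | z∈p′ , z∉q with ∈-↦⁻ p x y z∈p′
  ...   | inj₁ (z∈p , _) = x∈p─q⁺ z∈p z∉q
  ...   | inj₂ refl       = contradiction y∈q z∉q

p⊆q⇒∣q∣≤∣p∣⇒p≡q : p ⊆ˢ q → ∣ q ∣ ≤ ∣ p ∣ → p ≡ q
p⊆q⇒∣q∣≤∣p∣⇒p≡q {p = p} {q} p⊆q ∣q∣≤∣p∣ = ⊆-antisym p⊆q q⊆p
  where
  q⊆p : q ⊆ˢ p
  q⊆p {x} x∈q with x ∈? p
  ... | yes x∈p = x∈p
  ... | no  x∉p = contradiction (p⊂q⇒∣p∣<∣q∣ (p⊆q , x , x∈q , x∉p)) (≤⇒≯ ∣q∣≤∣p∣)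

x∈initSeg⁺ : ∀ {n k} {x : Fin n} → toℕ x < k → x ∈ initSeg n k
x∈initSeg⁺ {k = suc k} {Fin.zero}  _         = here
x∈initSeg⁺ {k = suc k} {Fin.suc x} (s≤s x<k) = there (x∈initSeg⁺ x<k)

x∈initSeg⁻ : ∀ {n k} {x : Fin n} → x ∈ initSeg n k → toℕ x < k
x∈initSeg⁻ {k = zero}  {Fin.suc x} (there x∈) with x∈initSeg⁻ {k = zero} x∈
... | ()
x∈initSeg⁻ {k = suc k} {Fin.zero}  _          = s≤s z≤n
x∈initSeg⁻ {k = suc k} {Fin.suc x} (there x∈) = s≤s (x∈initSeg⁻ x∈)

∣initSeg∣ : ∀ {k n} → k ≤ n → ∣ initSeg n k ∣ ≡ k
∣initSeg∣ {zero}  {zero}  z≤n       = refl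
∣initSeg∣ {zero}  {suc n} z≤n       = ∣initSeg∣ {zero} {n} z≤n
∣initSeg∣ {suc k} {suc n} (s≤s k≤n) = cong suc (∣initSeg∣ k≤n)

j<∣p∣⇒∃x∈p∧j≤x : ∀ {n j} {p : Subset n} → j < ∣ p ∣ → ∃ λ x → x ∈ p × j ≤ toℕ x
j<∣p∣⇒∃x∈p∧j≤x {n} {j} {p} j<∣p∣ with any? (λ x → x ∈? p ×-dec j ≤? toℕ x)
... | yes found = found
... | no  none  = contradiction ∣p∣≤j (<⇒≱ j<∣p∣)
  where
  p⊆initSeg : p ⊆ˢ initSeg n j
  p⊆initSeg {x} x∈p = x∈initSeg⁺ (≰⇒> λ j≤x → none (x , x∈p , j≤x))
  ∣p∣≤j : ∣ p ∣ ≤ j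
  ∣p∣≤j = begin
    ∣ p ∣            ≤⟨ p⊆q⇒∣p∣≤∣q∣ p⊆initSeg ⟩
    ∣ initSeg n j ∣  ≡⟨ ∣initSeg∣ (<⇒≤ (<-≤-trans j<∣p∣ (∣p∣≤n p))) ⟩
    j                ∎
    where open ≤-Reasoning

x∈shift⁺ : .{{_ : NonZero n}} {s : Fin n} → (x -ₙ s) ∈ p → x ∈ shift s p
x∈shift⁺ {x = x} x-s∈p = lookup⇒[]= x _ (trans (lookup∘tabulate _ x) ([]=⇒lookup x-s∈p))

module _ .{{_ : NonZero n}} where

  1ₙ : Fin n
  1ₙ = 1 mod n

  -1ₙ : Fin n
  -1ₙ = (n ∸ 1) mod n

  toℕ-mod : ∀ {m} → m < n → toℕ (m mod n) ≡ m
  toℕ-mod m<n = trans (toℕ-fromℕ< _) (m<n⇒m%n≡m m<n)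

  toℕ-sub : ∀ {y s : Fin n} → toℕ s ≤ toℕ y → toℕ (y -ₙ s) ≡ toℕ y ∸ toℕ s
  toℕ-sub {y} {s} s≤y = begin
    toℕ (y -ₙ s)               ≡⟨ toℕ-fromℕ< _ ⟩
    (toℕ y + (n ∸ toℕ s)) % n  ≡⟨ cong (_% n) (sym (+-∸-assoc (toℕ y) (<⇒≤ (toℕ<n s)))) ⟩
    (toℕ y + n ∸ toℕ s) % n    ≡⟨ cong (_% n) (+-∸-comm n s≤y) ⟩
    (toℕ y ∸ toℕ s + n) % n    ≡⟨ [m+n]%n≡m%n (toℕ y ∸ toℕ s) n ⟩
    (toℕ y ∸ toℕ s) % n        ≡⟨ m<n⇒m%n≡m (≤-<-trans (m∸n≤m (toℕ y) (toℕ s)) (toℕ<n y)) ⟩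
    toℕ y ∸ toℕ s              ∎
    where open ≡-Reasoning

  toℕ-sub-wrap : ∀ {y s : Fin n} → toℕ y < toℕ s → toℕ (y -ₙ s) ≡ toℕ y + (n ∸ toℕ s)
  toℕ-sub-wrap {y} {s} y<s = trans (toℕ-fromℕ< _) (m<n⇒m%n≡m (begin-strict
    toℕ y + (n ∸ toℕ s)  <⟨ +-monoˡ-< (n ∸ toℕ s) y<s ⟩
    toℕ s + (n ∸ toℕ s)  ≡⟨ m+[n∸m]≡n (<⇒≤ (toℕ<n s)) ⟩
    n                    ∎))
    where open ≤-Reasoning

  toℕ-sub-1ₙ : ∀ {y : Fin n} → 1 ≤ toℕ y → toℕ (y -ₙ 1ₙ) ≡ toℕ y ∸ 1
  toℕ-sub-1ₙ {y} 1≤y = trans (toℕ-sub (subst (_≤ toℕ y) (sym toℕ1ₙ) 1≤y)) (cong (toℕ y ∸_) toℕ1ₙ)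
    where
    toℕ1ₙ : toℕ 1ₙ ≡ 1
    toℕ1ₙ = toℕ-mod (≤-<-trans 1≤y (toℕ<n y))

  toℕ-sub--1ₙ : ∀ {y : Fin n} → suc (toℕ y) < n → toℕ (y -ₙ -1ₙ) ≡ suc (toℕ y)
  toℕ-sub--1ₙ {y} 1+y<n = begin
    toℕ (y -ₙ -1ₙ)         ≡⟨ toℕ-sub-wrap (subst (toℕ y <_) (sym toℕ-1ₙ) y<n-1) ⟩
    toℕ y + (n ∸ toℕ -1ₙ)  ≡⟨ cong (λ m → toℕ y + (n ∸ m)) toℕ-1ₙ ⟩
    toℕ y + (n ∸ (n ∸ 1))  ≡⟨ cong (toℕ y +_) (m∸[m∸n]≡n 1≤n) ⟩
    toℕ y + 1              ≡⟨ +-comm (toℕ y) 1 ⟩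
    suc (toℕ y)            ∎
    where
    open ≡-Reasoning
    1≤n : 1 ≤ n
    1≤n = ≤-<-trans z≤n 1+y<n
    y<n-1 : toℕ y < n ∸ 1
    y<n-1 = ∸-monoˡ-< 1+y<n (s≤s z≤n)
    toℕ-1ₙ : toℕ -1ₙ ≡ n ∸ 1
    toℕ-1ₙ = toℕ-mod (∸-monoʳ-< z<s 1≤n)

module BasisExchange {n : ℕ} {Basis : Subset n → Set} (M : IsMatroidBases n Basis) where
  open IsMatroidBases M

  Independent : Pred (Fin n) 0ℓ → Set
  Independent P = ∃ λ B → Basis B × P ⊆ (_∈ B)

  ⊆-independent : ∀ {P Q : Pred (Fin n) 0ℓ} → P ⊆ Q → Independent Q → Independent P
  ⊆-independent P⊆Q (B , B-basis , Q⊆B) = B , B-basis , λ x∈P → Q⊆B (P⊆Q x∈P)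

  rank≤n : ∀ {k} → HasRank n Basis k → k ≤ n
  rank≤n rank with nonempty
  ... | B , B-basis = subst (_≤ n) (rank B B-basis) (∣p∣≤n B)

  ∣p∣≡k⇒basis : ∀ {k p} → HasRank n Basis k → Independent (_∈ p) → ∣ p ∣ ≡ k → Basis p
  ∣p∣≡k⇒basis rank (B , B-basis , p⊆B) ∣p∣≡k =
    subst Basis (sym (p⊆q⇒∣q∣≤∣p∣⇒p≡q p⊆B (≤-reflexive (trans (rank B B-basis) (sym ∣p∣≡k))))) B-basis

  extend-towards : ∀ {I : Pred (Fin n) 0ℓ} {B′} → Decidable I → Independent I → Basis B′ →
                   ∃ λ B → Basis B × I ⊆ (_∈ B) × (_∈ B) ∖ (_∈ B′) ⊆ I
  extend-towards {I} {B′} I? (B₀ , B₀-basis , I⊆B₀) B′-basis =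
    go B₀ B₀-basis I⊆B₀ (<-wellFounded ∣ B₀ ─ B′ ∣)
    where
    go : ∀ B → Basis B → I ⊆ (_∈ B) → Acc _<_ ∣ B ─ B′ ∣ →
         ∃ λ B → Basis B × I ⊆ (_∈ B) × (_∈ B) ∖ (_∈ B′) ⊆ I
    go B B-basis I⊆B (acc smaller)
      with any? (λ x → x ∈? B ×-dec ¬? (x ∈? B′) ×-dec ¬? (I? x))
    ... | no none = B , B-basis , I⊆B , λ {x} (x∈B , x∉B′) →
            decidable-stable (I? x) (λ x∉I → none (x , x∈B , x∉B′ , x∉I))
    ... | yes (x , x∈B , x∉B′ , x∉I) with exchange B B′ B-basis B′-basis x x∈B x∉B′
    ...   | y , y∈B′ , _ , B[x↦y]-basis =
            go (B [ x ↦ y ]) B[x↦y]-basis (λ i∈I → ∈-↦⁺ (I⊆B i∈I) λ { refl → x∉I i∈I })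
               (smaller (∣p[x↦y]─q∣<∣p─q∣ x∈B x∉B′ y∈B′))

  -- Exchanging v ∈ B′ ∖ B brings in the unique a ∈ B ∖ B′; the resulting basis contains B,
  -- so u ∈ B′ ∖ B can no longer be exchanged against an element of B.
  atMostOne-∖-sym : ∀ {B B′} → Basis B → Basis B′ →
                    AtMostOne ((_∈ B) ∖ (_∈ B′)) → AtMostOne ((_∈ B′) ∖ (_∈ B))
  atMostOne-∖-sym {B} {B′} B-basis B′-basis unique {u} {v} (u∈B′ , u∉B) (v∈B′ , v∉B) with u ≟ v
  ... | yes u≡v = u≡v
  ... | no  u≢v with exchange B′ B B′-basis B-basis v v∈B′ v∉B
  ...   | a , a∈B , a∉B′ , B″-basis
        with exchange (B′ [ v ↦ a ]) B B″-basis B-basis u (∈-↦⁺ u∈B′ u≢v) u∉B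
  ...     | w , w∈B , w∉B″ , _ = contradiction w∈B″ w∉B″
    where
    w∈B″ : w ∈ B′ [ v ↦ a ]
    w∈B″ with w ∈? B′
    ... | yes w∈B′ = ∈-↦⁺ w∈B′ λ { refl → v∉B w∈B }
    ... | no  w∉B′ = subst (_∈ B′ [ v ↦ a ]) (unique (a∈B , a∉B′) (w∈B , w∉B′)) (∈-↦-new B′ v a)

  augment : ∀ {I J : Pred (Fin n) 0ℓ} → Decidable I → Independent I → Independent J →
            AtMostOne (I ∖ J) → ∃ λ B → Basis B × I ⊆ (_∈ B) × AtMostOne (J ∖ (_∈ B))
  augment I? I-indep (B′ , B′-basis , J⊆B′) unique
    with extend-towards I? I-indep B′-basis
  ... | B , B-basis , I⊆B , surplus⊆I =
    B , B-basis , I⊆B , λ (u∈J , u∉B) (v∈J , v∉B) →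
      atMostOne-∖-sym B-basis B′-basis surplus-unique (J⊆B′ u∈J , u∉B) (J⊆B′ v∈J , v∉B)
    where
    surplus-unique : AtMostOne ((_∈ B) ∖ (_∈ B′))
    surplus-unique (x∈B , x∉B′) (y∈B , y∉B′) =
      unique (surplus⊆I (x∈B , x∉B′) , x∉B′ ∘ J⊆B′) (surplus⊆I (y∈B , y∉B′) , y∉B′ ∘ J⊆B′)

module CyclicMatroid {n k : ℕ} .{{_ : NonZero n}} {Basis : Subset n → Set}
                     (C : IsCyclicMatroid n k Basis) where
  open IsCyclicMatroid C
  open IsMatroidBases isMatroid using (nonempty)
  open BasisExchange isMatroid

  independent-shift : ∀ {P : Pred (Fin n) 0ℓ} s → Independent P → Independent (λ y → P (y -ₙ s))
  independent-shift s (B , B-basis , P⊆B) =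
    shift s B , cyclic s B B-basis , λ y-s∈P → x∈shift⁺ {s = s} (P⊆B y-s∈P)

  Below : ℕ → Pred (Fin n) 0ℓ
  Below j y = toℕ y < j

  OneTo : ℕ → Pred (Fin n) 0ℓ
  OneTo j y = 1 ≤ toℕ y × toℕ y ≤ j

  oneTo? : ∀ j → Decidable (OneTo j)
  oneTo? j y = 1 ≤? toℕ y ×-dec toℕ y ≤? j

  atMostOne-oneTo∖below : ∀ {j} {P : Pred (Fin n) 0ℓ} → AtMostOne (OneTo j ∖ (Below j ∪ P))
  atMostOne-oneTo∖below {j} {P} x∈ y∈ = toℕ-injective (trans (≡j x∈) (sym (≡j y∈)))
    where
    ≡j : ∀ {z} → (OneTo j ∖ (Below j ∪ P)) z → toℕ z ≡ j
    ≡j ((_ , z≤j) , z∉) = ≤-antisym z≤j (≮⇒≥ (z∉ ∘ inj₁))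

  independent-shiftUp : ∀ {j} → Independent (Below j) → Independent (OneTo j)
  independent-shiftUp {j} below-indep = ⊆-independent shifted (independent-shift 1ₙ below-indep)
    where
    shifted : OneTo j ⊆ λ y → Below j (y -ₙ 1ₙ)
    shifted (1≤y , y≤j) = subst (_< j) (sym (toℕ-sub-1ₙ 1≤y)) (∸-monoˡ-< (s≤s y≤j) 1≤y)

  independent-shiftDown : ∀ {j} {e e′ : Fin n} → j < toℕ e → suc (toℕ e′) ≡ toℕ e →
                          Independent (OneTo j ∪ ｛ e ｝) → Independent (Below j ∪ ｛ e′ ｝)
  independent-shiftDown {j} {e} {e′} j<e 1+e′≡e independent =
    ⊆-independent shifted (independent-shift -1ₙ independent)
    where
    shifted : Below j ∪ ｛ e′ ｝ ⊆ λ y → (OneTo j ∪ ｛ e ｝) (y -ₙ -1ₙ)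
    shifted {y} (inj₁ y<j) = inj₁ (subst (λ m → 1 ≤ m × m ≤ j) (sym y-1≡1+y) (s≤s z≤n , y<j))
      where
      y-1≡1+y : toℕ (y -ₙ -1ₙ) ≡ suc (toℕ y)
      y-1≡1+y = toℕ-sub--1ₙ (<-trans (≤-<-trans y<j j<e) (toℕ<n e))
    shifted (inj₂ refl) =
      inj₂ (toℕ-injective (trans (sym 1+e′≡e) (sym (toℕ-sub--1ₙ (subst (_< n) (sym 1+e′≡e) (toℕ<n e))))))

  augment-step : ∀ {j} {e : Fin n} → j < toℕ e → Independent (Below j) → Independent (Below j ∪ ｛ e ｝) →
                 Independent (Below (suc j)) ⊎ Independent (OneTo j ∪ ｛ e ｝)
  -- For j = 0 we have 0 ∉ J = {e}, but then OneTo 0 ∪ {e} ⊆ J.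
  augment-step {zero} _ _ J-indep = inj₂ (⊆-independent oneTo0⊆ J-indep)
    where
    oneTo0⊆ : OneTo 0 ∪ ｛ _ ｝ ⊆ Below 0 ∪ ｛ _ ｝
    oneTo0⊆ (inj₁ (1≤y , y≤0)) = contradiction (≤-trans 1≤y y≤0) λ ()
    oneTo0⊆ (inj₂ e≡y)         = inj₂ e≡y
  augment-step {suc j} {e} j<e below-indep J-indep
    with augment (oneTo? (suc j)) (independent-shiftUp below-indep) J-indep
                 atMostOne-oneTo∖below
  ... | B , B-basis , oneTo⊆B , missing with e ∈? B
  ...   | yes e∈B = inj₂ (B , B-basis , [ oneTo⊆B , (λ { refl → e∈B }) ]′)
  ...   | no  e∉B = inj₁ (B , B-basis , below⊆B)
    where
    below⊆B : Below (suc (suc j)) ⊆ (_∈ B)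
    below⊆B {y} y<2+j with y ∈? B
    ... | yes y∈B = y∈B
    ... | no  y∉B = oneTo⊆B (n≢0⇒n>0 y≢0 , m<1+n⇒m≤n y<2+j)
      where
      y≢0 : toℕ y ≢ 0
      y≢0 y≡0 with missing (inj₁ (subst (_< suc j) (sym y≡0) z<s) , y∉B) (inj₂ refl , e∉B)
      ... | refl = contradiction (subst (suc j <_) y≡0 j<e) λ ()

  extend-below : ∀ d {j} {e : Fin n} → toℕ e ≡ j + d → Independent (Below j) →
                 Independent (Below j ∪ ｛ e ｝) → Independent (Below (suc j))
  extend-below zero {j} {e} e≡j+0 _ J-indep = ⊆-independent below⊆J J-indep
    where
    below⊆J : Below (suc j) ⊆ Below j ∪ ｛ e ｝
    below⊆J y<1+j = Sum.map₂ (λ y≡j → toℕ-injective (trans e≡j+0 (trans (+-identityʳ j) (sym y≡j))))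
                             (m<1+n⇒m<n∨m≡n y<1+j)
  extend-below (suc d) {j} {e} e≡j+1+d below-indep J-indep =
    [ id , (λ shifted → extend-below d (toℕ-fromℕ< j+d<n) below-indep
                                     (independent-shiftDown j<e 1+e′≡e shifted)) ]′
      (augment-step j<e below-indep J-indep)
    where
    e≡1+j+d : toℕ e ≡ suc (j + d)
    e≡1+j+d = trans e≡j+1+d (+-suc j d)
    j<e : j < toℕ e
    j<e = subst (j <_) (sym e≡j+1+d) (m<m+n j z<s)
    j+d<n : j + d < n
    j+d<n = <-trans (subst (j + d <_) (sym e≡1+j+d) ≤-refl) (toℕ<n e)
    1+e′≡e : suc (toℕ (fromℕ< j+d<n)) ≡ toℕ e
    1+e′≡e = trans (cong suc (toℕ-fromℕ< j+d<n)) (sym e≡1+j+d)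

  below-independent : ∀ j → j ≤ k → Independent (Below j)
  below-independent zero    _   = proj₁ nonempty , proj₂ nonempty , λ ()
  below-independent (suc j) j<k with below-independent j (<⇒≤ j<k)
  ... | B , B-basis , below⊆B with j<∣p∣⇒∃x∈p∧j≤x (subst (j <_) (sym (rank B B-basis)) j<k)
  ...   | e , e∈B , j≤e = extend-below (toℕ e ∸ j) (sym (m+[n∸m]≡n j≤e)) (B , B-basis , below⊆B)
                            (B , B-basis , [ below⊆B , (λ { refl → e∈B }) ]′)

proposition2p7 : (n k : ℕ) .{{_ : NonZero n}} (Basis : Subset n → Set) →
                 IsCyclicMatroid n k Basis → Basis (initSeg n k)
proposition2p7 n k Basis C = ∣p∣≡k⇒basis rank initSeg-independent (∣initSeg∣ (rank≤n rank))
  where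
  open IsCyclicMatroid C using (isMatroid; rank)
  open BasisExchange isMatroid using (Independent; ⊆-independent; rank≤n; ∣p∣≡k⇒basis)
  open CyclicMatroid C using (below-independent)
  initSeg-independent : Independent (_∈ initSeg n k)
  initSeg-independent = ⊆-independent x∈initSeg⁻ (below-independent k ≤-refl)
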